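{- Let $x\ge 0$. Let $B=\{g,l,v\}$ and $L=\{(\{g,l\},2x,1),(\{g,v\},x,1),(\{v,l\},x,1)\}$ (lines written as (endpoints, capacity, susceptance)), with $p^{\min}_l(l)=p^{\max}_l(l)=3x$, $p^{\max}_g(g)=3x$, and all other demand/generation bounds $0$ except as follows. Let $S^+$ be this network in which additionally $p^{\max}_g(v)=\infty$ (so $v$ is an unbounded generator), and $S^-$ the network in which additionally $p^{\min}_l(v)=0$, $p^{\max}_l(v)=\infty$ (so $v$ is an unbounded load). Then (1) no feasible solution $(S,\theta,p_g,p_l)$ of $S^-$ has $p_l(v)>0$; (2) $\{p_g(v): (S,\theta,p_g,p_l)\text{ a feasible solution of } S^+\}=\{0,x\}$.
   Context: A DC network is a tuple $(B,L,p^{\min}_l,p^{\max}_l,p^{\max}_g,c)$: buses $B$; lines $L$, each $(\{a,b\},\kappa,s)$ with capacity $\kappa$ and susceptance $s$; demand bounds $p^{\min}_l,p^{\max}_l$; maximum generation $p^{\max}_g$; costs $c$ (irrelevant here). Directed lines: $\vec L=\{(a,b,\kappa,s),(b,a,\kappa,s):(\{a,b\},\kappa,s)\in L\}$. A tuple $(S,\theta,p_g,p_l)$ with $S\subseteq L$ (switched-off lines, directed version $\vec S$), phase angles $\theta:B\to\mathbb R$, generation and load $p_g,p_l:B\to\mathbb R_{\ge0}$ defines flows $f(a,b,\kappa,s)=s(\theta(b)-\theta(a))$ on $\vec L\setminus\vec S$; it is a feasible solution if $|f(e)|\le\kappa$ for each $e=(a,b,\kappa,s)\in\vec L\setminus\vec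 S$, $p^{\min}_l\le p_l\le p^{\max}_l$ and $0\le p_g\le p^{\max}_g$ pointwise, and for each bus $a$ the sum of $f$ over the directed lines of $\vec L\setminus\vec S$ leaving $a$ equals $p_g(a)-p_l(a)$. A bound of $\infty$ means no bound. -}

module Defs where

open import Level using (0ℓ)
open import Algebra.Bundles using (CommutativeRing)
open import Relation.Binary.Core using (Rel)
open import Relation.Binary.Structures using (IsTotalOrder)
open import Relation.Binary.Definitions using (DecidableEquality)
open import Relation.Binary.PropositionalEquality using (_≡_; refl)
open import Relation.Nullary using (¬_; yes; no)
open import Data.Product using (_×_; ∃)
open import Data.Unit using (⊤)
open import Data.Empty using (⊥)
open import Data.Bool using (Bool; true; false; if_then_else_)
open import Data.List using (List; []; _∷_; length; lookup)
open import Data.Fin using (Fin)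
import Data.Fin as Fin
import Data.Nat as ℕ
open import Relation.Nullary using (does)

-- An ordered field (the usual axioms): a commutative ring with a total order
-- compatible with + and *, 0 ≠ 1, and inverses of nonzero elements.
-- ℝ is an instance; the statement is made for every ordered field.
record OrderedField : Set₁ where
  field
    commRing : CommutativeRing 0ℓ 0ℓ
  open CommutativeRing commRing public
  infix 4 _≤_ _<_
  field
    _≤_          : Rel Carrier 0ℓ
    isTotalOrder : IsTotalOrder _≈_ _≤_
    +-mono-≤     : ∀ {a b} c → a ≤ b → a + c ≤ b + c
    *-nonneg     : ∀ {a b} → 0# ≤ a → 0# ≤ b → 0# ≤ a * b
    0≉1          : ¬ (0# ≈ 1#)
    inverse      : ∀ a → ¬ (a ≈ 0#) → ∃ λ b → a * b ≈ 1#

  _<_ : Rel Carrier 0ℓ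
  a < b = a ≤ b × ¬ (a ≈ b)

data Bus3 : Set where
  g l v : Bus3

_≟3_ : DecidableEquality Bus3
g ≟3 g = yes refl
g ≟3 l = no λ ()
g ≟3 v = no λ ()
l ≟3 g = no λ ()
l ≟3 l = yes refl
l ≟3 v = no λ ()
v ≟3 g = no λ ()
v ≟3 l = no λ ()
v ≟3 v = yes refl


module DCNet (F : OrderedField) where
  open OrderedField F public

  data Bound : Set where
    fin : Carrier → Bound
    ∞   : Bound

  _≤ᵇ_ : Carrier → Bound → Set
  a ≤ᵇ fin c = a ≤ c
  a ≤ᵇ ∞     = ⊤

  -- an (undirected) line ({a,b}, κ, s)
  record Line (B : Set) : Set where
    constructor line
    field
      end₁ end₂ : B
      cap       : Bound
      sus       : Carrier

  -- a DC network (costs omitted: irrelevant here)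
  record Network : Set₁ where
    field
      Bus     : Set
      _≟B_    : DecidableEquality Bus
      lines   : List (Line Bus)
      plmin   : Bus → Carrier
      plmax   : Bus → Bound
      pgmax   : Bus → Bound

  -- a candidate solution (S, θ, p_g, p_l); S ⊆ L given by  off i ≡ true
  record Solution (N : Network) : Set where
    open Network N
    field
      off : Fin (length lines) → Bool
      θ   : Bus → Carrier
      pg  : Bus → Carrier
      pl  : Bus → Carrier

  sumFin : ∀ {m} → (Fin m → Carrier) → Carrier
  sumFin {ℕ.zero}  f = 0#
  sumFin {ℕ.suc m} f = f Fin.zero + sumFin (λ i → f (Fin.suc i))

  module _ {N : Network} (σ : Solution N) where
    open Network N
    open Solution σ

    flow : Bus → Bus → Carrier → Carrier
    flow a b s = s * (θ b - θ a)

    leaving : Line Bus → Bus → Carrier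
    leaving (line p q κ s) a =
      (if does (p ≟B a) then flow p q s else 0#)
      + (if does (q ≟B a) then flow q p s else 0#)

    netOut : Bus → Carrier
    netOut a = sumFin λ i →
      if off i then 0# else leaving (lookup lines i) a

    capOK : Line Bus → Set
    capOK (line p q κ s) = (flow p q s ≤ᵇ κ) × (flow q p s ≤ᵇ κ)

    record Feasible : Set where
      field
        capacity : ∀ i → off i ≡ false → capOK (lookup lines i)
        pl-min   : ∀ b → plmin b ≤ pl b
        pl-max   : ∀ b → pl b ≤ᵇ plmax b
        pl-nonneg : ∀ b → 0# ≤ pl b
        pg-nonneg : ∀ b → 0# ≤ pg b
        pg-max   : ∀ b → pg b ≤ᵇ pgmax b
        balance  : ∀ b → netOut b ≈ pg b - pl b

  example : Carrier → Bound → Bound → Network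
  example x pgmaxV plmaxV = record
    { Bus   = Bus3
    ; _≟B_  = _≟3_
    ; lines = line g l (fin (x + x)) 1#
            ∷ line g v (fin x) 1#
            ∷ line v l (fin x) 1#
            ∷ []
    ; plmin = λ { l → x + x + x ; _ → 0# }
    ; plmax = λ { l → fin (x + x + x) ; v → plmaxV ; g → fin 0# }
    ; pgmax = λ { g → fin (x + x + x) ; v → pgmaxV ; l → fin 0# }
    }

  S⁺ : Carrier → Network
  S⁺ x = example x ∞ (fin 0#)

  S⁻ : Carrier → Network
  S⁻ x = example x (fin 0#) ∞

module Submission where

-- Idea.  Write f_gl, f_gv, f_vl for the flows g→l, g→v, v→l (0 on a
-- switched-off line).  Power balance at the three buses reads
--     f_gl + f_gv = p_g(g),   f_gl + f_vl = 3x,   f_vl - f_gv = p_g(v) - p_l(v).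
-- (1) Eliminating the flows gives p_g(g) = 3x + p_l(v) ≤ 3x, so p_l(v) ≤ 0.
-- (2) Since f_gl ≤ 2x and f_vl ≤ x, balance at l saturates both lines:
--     f_gl = 2x and f_vl = x.  If g–v is off then p_g(v) = x; if it is on,
--     its flow θ(v) - θ(g) = f_gl - f_vl = x, so p_g(v) = 0 (when a line into
--     l is off, saturation forces x = 0 and the capacity of g–v gives the
--     same).  Both values occur: fix θ = (0, 2x, x) and switch g–v on or off.

open import Defs
open import Level using (0ℓ)
open import Algebra.Bundles using (CommutativeRing)
open import Algebra.Solver.Ring.AlmostCommutativeRing
  using (fromCommutativeRing; _-Raw-AlmostCommutative⟶_)
open import Data.Bool using (Bool; true; false; if_then_else_)
open import Data.Fin.Patterns using (0F; 1F; 2F)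
open import Data.Integer as ℤ using (ℤ; +_; -[1+_]; _⊖_; _◃_)
import Data.Integer.Properties as ℤ
open import Data.Maybe using (Maybe; just; nothing)
open import Data.Nat as ℕ using (ℕ; zero; suc)
import Data.Nat.Properties as ℕ
open import Data.Product using (_×_; Σ; _,_; proj₁; proj₂)
open import Data.Sign as Sign using (Sign)
open import Data.Sum as Sum using (_⊎_; inj₁; inj₂)
open import Data.Unit using (tt)
open import Function.Bundles using (_⇔_; mk⇔)
open import Relation.Nullary using (¬_; yes; no)
open import Relation.Binary.Structures using (IsTotalOrder)
import Relation.Binary.PropositionalEquality as ≡
open ≡ using (_≡_)

-- The canonical ring homomorphism ℤ → R into any commutative ring R, and
-- the ring solver with integer coefficients that it yields: it decides
-- every identity of commutative rings, including those needing cancellation.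
module IntegerCoefficients (R : CommutativeRing 0ℓ 0ℓ) where
  open CommutativeRing R
  open import Algebra.Properties.Ring ring using (-0#≈0#; -‿involutive; -‿distribˡ-*; -‿distribʳ-*; -‿+-comm)
  open import Algebra.Properties.Semiring.Mult.TCOptimised semiring
    using (1+×; ×-homo-+; ×1-homo-*) renaming (_×_ to _·1#_)
  open import Relation.Binary.Reasoning.Setoid setoid

  ⟦_⟧ℕ : ℕ → Carrier
  ⟦ n ⟧ℕ = n ·1# 1#

  ⟦_⟧ℤ : ℤ → Carrier
  ⟦ + n ⟧ℤ     = ⟦ n ⟧ℕ
  ⟦ -[1+ n ] ⟧ℤ = - ⟦ suc n ⟧ℕ

  shift-difference : ∀ c a b → (c + a) - (c + b) ≈ a - b
  shift-difference c a b = begin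
    (c + a) - (c + b)     ≈⟨ +-congˡ (-‿+-comm c b) ⟨
    (c + a) + (- c - b)   ≈⟨ +-congʳ (+-comm c a) ⟩
    (a + c) + (- c - b)   ≈⟨ +-assoc a c _ ⟩
    a + (c + (- c - b))   ≈⟨ +-congˡ (+-assoc c (- c) (- b)) ⟨
    a + ((c - c) - b)     ≈⟨ +-congˡ (+-congʳ (-‿inverseʳ c)) ⟩
    a + (0# - b)          ≈⟨ +-congˡ (+-identityˡ (- b)) ⟩
    a - b                 ∎

  ⊖-homo : ∀ m n → ⟦ m ⊖ n ⟧ℤ ≈ ⟦ m ⟧ℕ - ⟦ n ⟧ℕ
  ⊖-homo m zero = begin
    ⟦ m ⊖ 0 ⟧ℤ        ≡⟨ ≡.cong ⟦_⟧ℤ (ℤ.⊖-≥ {m} {0} ℕ.z≤n) ⟩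
    ⟦ m ⟧ℕ            ≈⟨ +-identityʳ _ ⟨
    ⟦ m ⟧ℕ + 0#       ≈⟨ +-congˡ -0#≈0# ⟨
    ⟦ m ⟧ℕ - ⟦ 0 ⟧ℕ   ∎
  ⊖-homo zero (suc n) = begin
    ⟦ 0 ⊖ suc n ⟧ℤ    ≡⟨ ≡.cong ⟦_⟧ℤ (ℤ.⊖-< {0} {suc n} ℕ.z<s) ⟩
    - ⟦ suc n ⟧ℕ      ≈⟨ +-identityˡ _ ⟨
    0# - ⟦ suc n ⟧ℕ   ∎
  ⊖-homo (suc m) (suc n) = begin
    ⟦ suc m ⊖ suc n ⟧ℤ              ≡⟨ ≡.cong ⟦_⟧ℤ (ℤ.[1+m]⊖[1+n]≡m⊖n m n) ⟩
    ⟦ m ⊖ n ⟧ℤ                      ≈⟨ ⊖-homo m n ⟩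
    ⟦ m ⟧ℕ - ⟦ n ⟧ℕ                 ≈⟨ shift-difference 1# _ _ ⟨
    (1# + ⟦ m ⟧ℕ) - (1# + ⟦ n ⟧ℕ)   ≈⟨ +-cong (1+× m 1#) (-‿cong (1+× n 1#)) ⟨
    ⟦ suc m ⟧ℕ - ⟦ suc n ⟧ℕ         ∎

  +-homo : ∀ i j → ⟦ i ℤ.+ j ⟧ℤ ≈ ⟦ i ⟧ℤ + ⟦ j ⟧ℤ
  +-homo (+ m)    (+ n)    = ×-homo-+ 1# m n
  +-homo (+ m)    -[1+ n ] = ⊖-homo m (suc n)
  +-homo -[1+ m ] (+ n)    = trans (⊖-homo n (suc m)) (+-comm _ _)
  +-homo -[1+ m ] -[1+ n ] = begin
    - ⟦ suc (suc (m ℕ.+ n)) ⟧ℕ       ≡⟨ ≡.cong (λ k → - ⟦ suc k ⟧ℕ) (ℕ.+-suc m n) ⟨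
    - ⟦ suc m ℕ.+ suc n ⟧ℕ           ≈⟨ -‿cong (×-homo-+ 1# (suc m) (suc n)) ⟩
    - (⟦ suc m ⟧ℕ + ⟦ suc n ⟧ℕ)      ≈⟨ -‿+-comm _ _ ⟨
    - ⟦ suc m ⟧ℕ - ⟦ suc n ⟧ℕ        ∎

  -- multiplication is handled through the sign–magnitude decomposition
  signed : Sign → Carrier → Carrier
  signed Sign.+ a = a
  signed Sign.- a = - a

  signed-cong : ∀ s {a b} → a ≈ b → signed s a ≈ signed s b
  signed-cong Sign.+ e = e
  signed-cong Sign.- e = -‿cong e

  ◃-homo : ∀ s n → ⟦ s ◃ n ⟧ℤ ≈ signed s ⟦ n ⟧ℕ
  ◃-homo Sign.+ zero    = refl
  ◃-homo Sign.- zero    = sym -0#≈0#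
  ◃-homo Sign.+ (suc n) = refl
  ◃-homo Sign.- (suc n) = refl

  signed-* : ∀ s t a b → signed (s Sign.* t) (a * b) ≈ signed s a * signed t b
  signed-* Sign.+ Sign.+ a b = refl
  signed-* Sign.+ Sign.- a b = -‿distribʳ-* a b
  signed-* Sign.- Sign.+ a b = -‿distribˡ-* a b
  signed-* Sign.- Sign.- a b = begin
    a * b          ≈⟨ -‿involutive _ ⟨
    - - (a * b)    ≈⟨ -‿cong (-‿distribˡ-* a b) ⟩
    - (- a * b)    ≈⟨ -‿distribʳ-* (- a) b ⟩
    - a * - b      ∎

  sign-magnitude : ∀ i → ⟦ i ⟧ℤ ≈ signed (ℤ.sign i) ⟦ ℤ.∣ i ∣ ⟧ℕ
  sign-magnitude (+ n)    = refl
  sign-magnitude -[1+ n ] = refl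

  *-homo : ∀ i j → ⟦ i ℤ.* j ⟧ℤ ≈ ⟦ i ⟧ℤ * ⟦ j ⟧ℤ
  *-homo i j = begin
    ⟦ s ◃ ∣i∣ ℕ.* ∣j∣ ⟧ℤ                                 ≈⟨ ◃-homo s (∣i∣ ℕ.* ∣j∣) ⟩
    signed s ⟦ ∣i∣ ℕ.* ∣j∣ ⟧ℕ                            ≈⟨ signed-cong s (×1-homo-* ∣i∣ ∣j∣) ⟩
    signed s (⟦ ∣i∣ ⟧ℕ * ⟦ ∣j∣ ⟧ℕ)                       ≈⟨ signed-* (ℤ.sign i) (ℤ.sign j) _ _ ⟩
    signed (ℤ.sign i) ⟦ ∣i∣ ⟧ℕ * signed (ℤ.sign j) ⟦ ∣j∣ ⟧ℕ ≈⟨ *-cong (sign-magnitude i) (sign-magnitude j) ⟨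
    ⟦ i ⟧ℤ * ⟦ j ⟧ℤ                                       ∎
    where
    s = ℤ.sign i Sign.* ℤ.sign j
    ∣i∣ = ℤ.∣ i ∣
    ∣j∣ = ℤ.∣ j ∣

  -‿homo : ∀ i → ⟦ ℤ.- i ⟧ℤ ≈ - ⟦ i ⟧ℤ
  -‿homo (+ zero)  = sym -0#≈0#
  -‿homo (+ suc n) = refl
  -‿homo -[1+ n ]  = sym (-‿involutive _)

  homomorphism : ℤ.+-*-rawRing -Raw-AlmostCommutative⟶ fromCommutativeRing R
  homomorphism = record
    { ⟦_⟧ = ⟦_⟧ℤ ; +-homo = +-homo ; *-homo = *-homo ; -‿homo = -‿homo
    ; 0-homo = refl ; 1-homo = refl }

  coefficient-equality : ∀ i j → Maybe (⟦ i ⟧ℤ ≈ ⟦ j ⟧ℤ)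
  coefficient-equality i j with i ℤ.≟ j
  ... | yes ≡.refl = just refl
  ... | no _       = nothing

  open import Algebra.Solver.Ring ℤ.+-*-rawRing (fromCommutativeRing R) homomorphism coefficient-equality public

module OrderedFieldFacts (F : OrderedField) where
  open OrderedField F
  open IsTotalOrder isTotalOrder public
    using (antisym; ≤-respˡ-≈; ≤-respʳ-≈)
    renaming (refl to ≤-refl; reflexive to ≤-reflexive; trans to ≤-trans)
  open IntegerCoefficients commRing using (solve; _:=_; _:+_; _:-_)

  +-monoˡ-≤ : ∀ c {a b} → a ≤ b → c + a ≤ c + b
  +-monoˡ-≤ c {a} {b} a≤b = ≤-respʳ-≈ (+-comm b c) (≤-respˡ-≈ (+-comm a c) (+-mono-≤ c a≤b))

  +-cancelʳ-≤ : ∀ c {a b} → a + c ≤ b + c → a ≤ b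
  +-cancelʳ-≤ c {a} {b} h =
    ≤-respʳ-≈ (cancel b c) (≤-respˡ-≈ (cancel a c) (+-mono-≤ (- c) h))
    where
    cancel : ∀ a c → (a + c) - c ≈ a
    cancel = solve 2 (λ a c → (a :+ c) :- c := a) refl

  +-cancelˡ-≤ : ∀ c {a b} → c + a ≤ c + b → a ≤ b
  +-cancelˡ-≤ c {a} {b} h =
    +-cancelʳ-≤ c (≤-respʳ-≈ (+-comm c b) (≤-respˡ-≈ (+-comm c a) h))

  +-nonneg : ∀ {a b} → 0# ≤ a → 0# ≤ b → 0# ≤ a + b
  +-nonneg {a = a} 0≤a 0≤b =
    ≤-respˡ-≈ (+-identityʳ 0#) (≤-trans (+-mono-≤ 0# 0≤a) (+-monoˡ-≤ a 0≤b))

  neg-≤ : ∀ {a} → 0# ≤ a → - a ≤ a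
  neg-≤ {a} 0≤a = ≤-trans neg-a≤0 0≤a
    where
    neg-a≤0 : - a ≤ 0#
    neg-a≤0 = ≤-respʳ-≈ (-‿inverseʳ a) (≤-respˡ-≈ (+-identityˡ (- a)) (+-mono-≤ (- a) 0≤a))

  -- Saturation: if two quantities are bounded by A and B and sum to A + B,
  -- both bounds are attained.  This is how balance at bus l pins the flows.
  saturateˡ : ∀ {a b A B} → a ≤ A → b ≤ B → a + b ≈ A + B → a ≈ A
  saturateˡ {a = a} {B = B} a≤A b≤B sum =
    antisym a≤A (+-cancelʳ-≤ B (≤-respˡ-≈ sum (+-monoˡ-≤ a b≤B)))

  saturate : ∀ {a b A B} → a ≤ A → b ≤ B → a + b ≈ A + B → a ≈ A × b ≈ B
  saturate {a} {b} {A} {B} a≤A b≤B sum =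
    saturateˡ a≤A b≤B sum ,
    saturateˡ b≤B a≤A (trans (+-comm b a) (trans sum (+-comm A B)))

  squeeze : ∀ {x t s} → x ≈ 0# → t ≤ x → s ≤ x → t + s ≈ 0# → t ≈ x
  squeeze x≈0 t≤x s≤x sum = trans
    (saturateˡ (≤-respʳ-≈ x≈0 t≤x) (≤-respʳ-≈ x≈0 s≤x) (trans sum (sym (+-identityˡ 0#))))
    (sym x≈0)

module ThreeBus (F : OrderedField) where
  open DCNet F
  open OrderedFieldFacts F
  open IntegerCoefficients commRing using (Polynomial; solve; _:=_; _:+_; _:-_; :-_; _:*_; con)
  open import Algebra.Properties.Ring ring using (-0#≈0#)
  open import Relation.Binary.Reasoning.Setoid setoid

  :0 :1 : ∀ {n} → Polynomial n
  :0 = con (+ 0)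
  :1 = con (+ 1)

  minus-zero : ∀ a → a - 0# ≈ a
  minus-zero = solve 1 (λ a → a :- :0 := a) refl

  -- the contribution of a line that may be switched off
  on : Bool → Carrier → Carrier
  on o t = if o then 0# else t

  on-cong : ∀ o {s t} → s ≈ t → on o s ≈ on o t
  on-cong true  _ = refl
  on-cong false e = e

  on-neg : ∀ o t → on o (- t) ≈ - on o t
  on-neg true  _ = sym -0#≈0#
  on-neg false _ = refl

  on-bound : ∀ o {t κ} → 0# ≤ κ → (o ≡ false → t ≤ κ) → on o t ≤ κ
  on-bound true  0≤κ _ = 0≤κ
  on-bound false _   h = h ≡.refl

  on-nonneg : ∀ o {t} → 0# ≤ t → 0# ≤ on o t
  on-nonneg true  _   = ≤-refl
  on-nonneg false 0≤t = 0≤t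

  unit-flow : ∀ {t κ} → 1# * t ≤ κ → t ≤ κ
  unit-flow {t} = ≤-respˡ-≈ (*-identityˡ t)

  forward : ∀ o p q → on o (1# * (q - p) + 0#) ≈ on o (q - p)
  forward o p q = on-cong o (solve 2 (λ p q → :1 :* (q :- p) :+ :0 := q :- p) refl p q)

  backward : ∀ o p q → on o (0# + 1# * (p - q)) ≈ - on o (q - p)
  backward o p q = trans
    (on-cong o (solve 2 (λ p q → :0 :+ :1 :* (p :- q) := :- (q :- p)) refl p q))
    (on-neg o (q - p))

  absent : ∀ o → on o (0# + 0#) ≈ 0#
  absent true  = refl
  absent false = +-identityˡ 0#

  -- Flows of a solution of the example network, oriented g→l, g→v, v→l.
  -- Lines are numbered 0F = g–l, 1F = g–v, 2F = v–l.
  module Flows {x : Carrier} {P Q : Bound} (σ : Solution (example x P Q)) where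
    open Solution σ

    f-gl f-gv f-vl : Carrier
    f-gl = on (off 0F) (θ l - θ g)
    f-gv = on (off 1F) (θ v - θ g)
    f-vl = on (off 2F) (θ l - θ v)

    netOut-g : netOut σ g ≈ f-gl + f-gv
    netOut-g = trans
      (+-cong (forward (off 0F) _ _) (+-cong (forward (off 1F) _ _) (+-congʳ (absent (off 2F)))))
      (solve 2 (λ a b → a :+ (b :+ (:0 :+ :0)) := a :+ b) refl f-gl f-gv)

    netOut-l : netOut σ l ≈ - (f-gl + f-vl)
    netOut-l = trans
      (+-cong (backward (off 0F) _ _) (+-cong (absent (off 1F)) (+-congʳ (backward (off 2F) _ _))))
      (solve 2 (λ a b → :- a :+ (:0 :+ (:- b :+ :0)) := :- (a :+ b)) refl f-gl f-vl)

    netOut-v : netOut σ v ≈ f-vl - f-gv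
    netOut-v = trans
      (+-cong (absent (off 0F)) (+-cong (backward (off 1F) _ _) (+-congʳ (forward (off 2F) _ _))))
      (solve 2 (λ a b → :0 :+ (:- a :+ (b :+ :0)) := b :- a) refl f-gv f-vl)

    -- Power balance at the three buses, using the fixed bounds of the
    -- example: p_l(g) = 0, p_g(l) = 0 and p_l(l) = 3x.
    module Balance (feasible : Feasible σ) where
      open Feasible feasible

      balance-g : f-gl + f-gv ≈ pg g
      balance-g = begin
        f-gl + f-gv     ≈⟨ netOut-g ⟨
        netOut σ g      ≈⟨ balance g ⟩
        pg g - pl g     ≈⟨ +-congˡ (-‿cong (antisym (pl-max g) (pl-nonneg g))) ⟩
        pg g - 0#       ≈⟨ minus-zero (pg g) ⟩
        pg g            ∎

      balance-l : f-gl + f-vl ≈ x + x + x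
      balance-l = begin
        f-gl + f-vl              ≈⟨ solve 1 (λ a → a := :0 :- (:- a)) refl (f-gl + f-vl) ⟩
        0# - - (f-gl + f-vl)     ≈⟨ +-congˡ (-‿cong (trans (sym netOut-l) (balance l))) ⟩
        0# - (pg l - pl l)       ≈⟨ +-congˡ (-‿cong (+-cong (antisym (pg-max l) (pg-nonneg l))
                                                             (-‿cong (antisym (pl-max l) (pl-min l))))) ⟩
        0# - (0# - (x + x + x))  ≈⟨ solve 1 (λ y → :0 :- (:0 :- y) := y) refl (x + x + x) ⟩
        x + x + x                ∎

      balance-v : f-vl - f-gv ≈ pg v - pl v
      balance-v = trans (sym netOut-v) (balance v)

  -- Part (1): generation at g must cover the load 3x at l plus the load at v,
  -- but is capped at 3x, so v draws nothing.
  no-load-at-v : ∀ {x} (σ : Solution (S⁻ x)) → Feasible σ → ¬ (0# < Solution.pl σ v)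
  no-load-at-v {x} σ feasible (_ , 0≉plv) = 0≉plv (antisym (pl-nonneg v) plv≤0)
    where
    open Solution σ
    open Feasible feasible
    open Flows σ
    open Balance feasible

    generation-at-g : pg g ≈ x + x + x + pl v
    generation-at-g = begin
      pg g                               ≈⟨ balance-g ⟨
      f-gl + f-gv                        ≈⟨ solve 3 (λ a b c → a :+ b := (a :+ c) :- (c :- b)) refl f-gl f-gv f-vl ⟩
      (f-gl + f-vl) - (f-vl - f-gv)      ≈⟨ +-cong balance-l (-‿cong balance-v) ⟩
      (x + x + x) - (pg v - pl v)        ≈⟨ +-congˡ (-‿cong (+-congʳ (antisym (pg-max v) (pg-nonneg v)))) ⟩
      (x + x + x) - (0# - pl v)          ≈⟨ solve 2 (λ y p → y :- (:0 :- p) := y :+ p) refl (x + x + x) (pl v) ⟩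
      x + x + x + pl v                   ∎

    plv≤0 : pl v ≤ 0#
    plv≤0 = +-cancelˡ-≤ (x + x + x)
      (≤-respʳ-≈ (sym (+-identityʳ _)) (≤-respˡ-≈ generation-at-g (pg-max g)))

  -- With both lines into l saturated (f_gl = 2x, f_vl = x), the flow t on a
  -- switched-on line g–v equals x; s is its reverse flow.  If a line into l is
  -- off, saturation forces x = 0 and the capacity x of g–v squeezes t.
  gv-forced : ∀ {x A B t s} o-gl o-vl → 0# ≤ x → t ≈ A - B → t + s ≈ 0# → t ≤ x → s ≤ x
            → on o-gl A ≈ x + x → on o-vl B ≈ x → t ≈ x
  gv-forced {x} false false _ t≈A-B _ _ _ A≈2x B≈x =
    trans t≈A-B (trans (+-cong A≈2x (-‿cong B≈x)) (solve 1 (λ x → (x :+ x) :- x := x) refl x))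
  gv-forced true _ 0≤x _ sum t≤x s≤x 0≈2x _ =
    squeeze (sym (saturateˡ 0≤x 0≤x (trans (+-identityˡ 0#) 0≈2x))) t≤x s≤x sum
  gv-forced false true _ _ sum t≤x s≤x _ 0≈x = squeeze (sym 0≈x) t≤x s≤x sum

  two-values : ∀ o {y x t} → y ≈ x - on o t → (o ≡ false → t ≈ x) → y ≈ 0# ⊎ y ≈ x
  two-values true  {x = x} y≈x-0 _ =
    inj₂ (trans y≈x-0 (minus-zero x))
  two-values false {x = x} y≈x-t t≈x =
    inj₁ (trans y≈x-t (trans (+-congˡ (-‿cong (t≈x ≡.refl))) (-‿inverseʳ x)))

  generation-at-v : ∀ {x} → 0# ≤ x → (σ : Solution (S⁺ x)) → Feasible σ
                  → Solution.pg σ v ≈ 0# ⊎ Solution.pg σ v ≈ x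
  generation-at-v {x} 0≤x σ feasible = two-values (off 1F) output-at-v gv-flow
    where
    open Solution σ
    open Feasible feasible
    open Flows σ
    open Balance feasible

    into-l-saturated : f-gl ≈ x + x × f-vl ≈ x
    into-l-saturated = saturate
      (on-bound (off 0F) (+-nonneg 0≤x 0≤x) (λ gl-on → unit-flow (proj₁ (capacity 0F gl-on))))
      (on-bound (off 2F) 0≤x (λ vl-on → unit-flow (proj₁ (capacity 2F vl-on))))
      balance-l

    output-at-v : pg v ≈ x - f-gv
    output-at-v = begin
      pg v             ≈⟨ minus-zero (pg v) ⟨
      pg v - 0#        ≈⟨ +-congˡ (-‿cong (antisym (pl-max v) (pl-nonneg v))) ⟨
      pg v - pl v      ≈⟨ balance-v ⟨
      f-vl - f-gv      ≈⟨ +-congʳ (proj₂ into-l-saturated) ⟩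
      x - f-gv         ∎

    gv-flow : off 1F ≡ false → θ v - θ g ≈ x
    gv-flow gv-on = gv-forced (off 0F) (off 2F) 0≤x
      (solve 3 (λ a b c → b :- a := (c :- a) :- (c :- b)) refl (θ g) (θ v) (θ l))
      (solve 2 (λ a b → (b :- a) :+ (a :- b) := :0) refl (θ g) (θ v))
      (unit-flow (proj₁ (capacity 1F gv-on))) (unit-flow (proj₂ (capacity 1F gv-on)))
      (proj₁ into-l-saturated) (proj₂ into-l-saturated)

  -- Part (2), sufficiency: with θ = (0, 2x, x) every switched-on line carries
  -- exactly its capacity; keeping g–v on gives p_g(v) = 0, switching it off x.
  module Witnesses {x : Carrier} (0≤x : 0# ≤ x) where

    witness : (gv-off : Bool) → Solution (S⁺ x)
    witness gv-off = record
      { off = λ { 0F → false ; 1F → gv-off ; 2F → false }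
      ; θ   = λ { g → 0# ; l → x + x ; v → x }
      ; pg  = λ { g → x + x + on gv-off x ; l → 0# ; v → x - on gv-off x }
      ; pl  = λ { l → x + x + x ; _ → 0# }
      }

    saturated-line : ∀ {p q κ} → 0# ≤ κ → q - p ≈ κ → (1# * (q - p) ≤ κ) × (1# * (p - q) ≤ κ)
    saturated-line {p} {q} 0≤κ q-p≈κ =
      ≤-reflexive (trans (*-identityˡ (q - p)) q-p≈κ) ,
      ≤-respˡ-≈ (sym (trans reverse (-‿cong q-p≈κ))) (neg-≤ 0≤κ)
      where
      reverse : 1# * (p - q) ≈ - (q - p)
      reverse = solve 2 (λ p q → :1 :* (p :- q) := :- (q :- p)) refl p q

    0≤2x : 0# ≤ x + x
    0≤2x = +-nonneg 0≤x 0≤x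

    output-nonneg : ∀ o → 0# ≤ x - on o x
    output-nonneg true  = ≤-respʳ-≈ (sym (minus-zero x)) 0≤x
    output-nonneg false = ≤-reflexive (sym (-‿inverseʳ x))

    feasible : ∀ o → Feasible (witness o)
    feasible o = record
      { capacity  = λ { 0F _ → saturated-line 0≤2x (minus-zero (x + x))
                      ; 1F _ → saturated-line 0≤x (minus-zero x)
                      ; 2F _ → saturated-line 0≤x (solve 1 (λ x → (x :+ x) :- x := x) refl x) }
      ; pl-min    = λ { g → ≤-refl ; l → ≤-refl ; v → ≤-refl }
      ; pl-max    = λ { g → ≤-refl ; l → ≤-refl ; v → ≤-refl }
      ; pl-nonneg = λ { g → ≤-refl ; l → +-nonneg 0≤2x 0≤x ; v → ≤-refl }
      ; pg-nonneg = λ { g → +-nonneg 0≤2x (on-nonneg o 0≤x) ; l → ≤-refl ; v → output-nonneg o }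
      ; pg-max    = λ { g → +-monoˡ-≤ (x + x) (on-bound o 0≤x (λ _ → ≤-refl)) ; l → ≤-refl ; v → tt }
      ; balance   = λ { g → trans netOut-g (trans (+-congˡ (on-cong o (minus-zero x)))
                              (solve 2 (λ x w → ((x :+ x) :- :0) :+ w := (x :+ x :+ w) :- :0)
                                       refl x (on o x)))
                      ; l → trans netOut-l
                              (solve 1 (λ x → :- (((x :+ x) :- :0) :+ ((x :+ x) :- x))
                                           := :0 :- (x :+ x :+ x)) refl x)
                      ; v → trans netOut-v (trans (+-congˡ (-‿cong (on-cong o (minus-zero x))))
                              (solve 2 (λ x w → ((x :+ x) :- x) :- w := (x :- w) :- :0)
                                       refl x (on o x))) }
      }
      where open Flows (witness o)

    realize : ∀ {y} → y ≈ 0# ⊎ y ≈ x → Σ (Solution (S⁺ x)) λ σ → Feasible σ × Solution.pg σ v ≈ y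
    realize (inj₁ y≈0) = witness false , feasible false , trans (-‿inverseʳ x) (sym y≈0)
    realize (inj₂ y≈x) = witness true , feasible true , trans (minus-zero x) (sym y≈x)

lemma3 : (F : OrderedField) → let open DCNet F in
    (x : Carrier) → 0# ≤ x →
    (∀ (σ : Solution (S⁻ x)) → Feasible σ → ¬ (0# < Solution.pl σ v))
    × (∀ (y : Carrier) →
    (Σ (Solution (S⁺ x)) λ σ → Feasible σ × Solution.pg σ v ≈ y)
    ⇔ (y ≈ 0# ⊎ y ≈ x))
lemma3 F x 0≤x = no-load-at-v , λ _ → mk⇔ necessary realize
  where
  open ThreeBus F
  open DCNet F
  open Witnesses 0≤x

  necessary : ∀ {y} → (Σ (Solution (S⁺ x)) λ σ → Feasible σ × Solution.pg σ v ≈ y) → y ≈ 0# ⊎ y ≈ x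
  necessary (σ , feasible , pgv≈y) = Sum.map (trans (sym pgv≈y)) (trans (sym pgv≈y)) (generation-at-v 0≤x σ feasible)
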